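{- Every finite involution semigroup $\mathcal{S}$ divides a finite direct product of syntactic $\star$-semigroups of languages recognised by $\mathcal{S}$ (that is, $\mathcal{S}$ is the image under a surjective morphism of involution semigroups of a sub-$\star$-semigroup of such a product).
   Context: Involution semigroup $(S,\star)$: $(a^\star)^\star=a$, $(ab)^\star=b^\star a^\star$; morphisms commute with involutions; sub-$\star$-semigroups are closed under product and involution; the direct product of $(S,\star),(T,\dagger)$ is $S\times T$ with involution $(x,y)\mapsto(x^\star,y^\dagger)$. A finite involutory alphabet $(A,\dagger)$ is a finite set with a bijection $\dagger$, $(a^\dagger)^\dagger=a$, extended to words by $(a_1\cdots a_n)^\dagger=a_n^\dagger\cdots a_1^\dagger$. $(S,\star)$ recognises $L\subseteq A^{+}$ if there are a morphism of involution semigroups $h:(A^{+},\dagger)\to(S,\star)$ and $P\subseteq S$ with $L=h^{ -1}(P)$. Syntactic congruence: $x\sim_L y$ iff $\forall u,v\in A^{*}$, $uxv\in L\Leftrightarrow uyv\in L$; syntactic $\star$-congruence: $x\approx_L y$ iff $x\sim_L y$ and $x\sim_{L^\dagger}y$ with $L^\dagger=\{w^\dagger:w\in L\}$; the syntactic $\star$-semigroup is $A^{+}/\approx_L$ with involution $[\![w]\!]\mapsto[\![w^\dagger]\!]$. -}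

module Defs where

open import Data.Nat using (ℕ)
open import Data.Fin using (Fin)
open import Data.List using (List)
open import Data.List.NonEmpty using (List⁺; map; reverse; _⁺++⁺_; _⁺++_; _++⁺_)
open import Data.Product using (Σ; ∃; ∃-syntax; _×_)
open import Function.Bundles using (_↔_; _⇔_)
open import Relation.Binary.PropositionalEquality using (_≡_)

record InvSemigroup : Set₁ where
  field
    Carrier   : Set
    _∙_       : Carrier → Carrier → Carrier
    _⋆        : Carrier → Carrier
    assoc     : ∀ x y z → (x ∙ y) ∙ z ≡ x ∙ (y ∙ z)
    ⋆-invol   : ∀ x → (x ⋆) ⋆ ≡ x
    ⋆-anti    : ∀ x y → (x ∙ y) ⋆ ≡ (y ⋆) ∙ (x ⋆)

open InvSemigroup public

IsFinite : InvSemigroup → Set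
IsFinite S = ∃[ m ] (Carrier S ↔ Fin m)

record InvAlphabet : Set where
  field
    size     : ℕ
    inv      : Fin size → Fin size
    inv-invol : ∀ a → inv (inv a) ≡ a

open InvAlphabet public

Word : InvAlphabet → Set
Word A = List⁺ (Fin (size A))

dagW : (A : InvAlphabet) → Word A → Word A
dagW A w = reverse (map (inv A) w)

Language : InvAlphabet → Set₁
Language A = Word A → Set

IsInvMorphism : (A : InvAlphabet) (S : InvSemigroup) → (Word A → Carrier S) → Set
IsInvMorphism A S h =
  (∀ u v → h (u ⁺++⁺ v) ≡ _∙_ S (h u) (h v)) × (∀ u → h (dagW A u) ≡ _⋆ S (h u))

Recognises : (S : InvSemigroup) (A : InvAlphabet) → Language A → Set₁
Recognises S A L =
  Σ (Word A → Carrier S) λ h → IsInvMorphism A S h ×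
  Σ (Carrier S → Set) λ P → ∀ w → L w ⇔ P (h w)

Syn∼ : (A : InvAlphabet) → Language A → Word A → Word A → Set
Syn∼ A L x y = ∀ (u v : List (Fin (size A))) → L (u ++⁺ (x ⁺++ v)) ⇔ L (u ++⁺ (y ⁺++ v))

Dag : (A : InvAlphabet) → Language A → Language A
Dag A L w = ∃[ v ] (L v × w ≡ dagW A v)

-- Syntactic ⋆-congruence ≈_L; the syntactic ⋆-semigroup is A⁺/≈_L with
-- product induced by concatenation and involution [w] ↦ [w†]; we work with
-- representatives (words) modulo ≈_L (setoid presentation of the quotient).
Syn≈ : (A : InvAlphabet) → Language A → Word A → Word A → Set
Syn≈ A L x y = Syn∼ A L x y × Syn∼ A (Dag A L) x y

-- Direct product of the syntactic ⋆-semigroups of L₀,…,L_{n-1}: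
-- elements are tuples of representatives, compared componentwise.
Tuple : InvAlphabet → ℕ → Set
Tuple A n = Fin n → Word A

_≈ₚ_ : ∀ {A n} {Ls : Fin n → Language A} → Tuple A n → Tuple A n → Set
_≈ₚ_ {A} {n} {Ls} s t = ∀ i → Syn≈ A (Ls i) (s i) (t i)

mulₚ : ∀ {A n} → Tuple A n → Tuple A n → Tuple A n
mulₚ s t i = s i ⁺++⁺ t i

starₚ : ∀ {A n} → Tuple A n → Tuple A n
starₚ {A} s i = dagW A (s i)

-- S divides ∏ᵢ A⁺/≈_{Lᵢ}: there is a sub-⋆-semigroup T of the product
-- (a subset of the quotient, i.e. a ≈-saturated predicate on representatives,
-- closed under product and involution) and a surjective morphism of
-- involution semigroups φ : T → S (well defined on classes).
Divides : (S : InvSemigroup) (A : InvAlphabet) (n : ℕ) (Ls : Fin n → Language A) → Set₁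
Divides S A n Ls =
  Σ (Tuple A n → Set) λ T →
  Σ (Tuple A n → Carrier S) λ φ →
    (∀ s t → _≈ₚ_ {A} {n} {Ls} s t → T s → T t)
  × (∀ s t → T s → T t → T (mulₚ {A} s t))
  × (∀ s → T s → T (starₚ {A} s))
  × (∀ s t → T s → T t → _≈ₚ_ {A} {n} {Ls} s t → φ s ≡ φ t)
  × (∀ s t → T s → T t → φ (mulₚ {A} s t) ≡ _∙_ S (φ s) (φ t))
  × (∀ s → T s → φ (starₚ {A} s) ≡ _⋆ S (φ s))
  × (∀ x → ∃[ s ] (T s × φ s ≡ x))

{-# OPTIONS --safe #-}

-- Take the elements of S as letters, with a† = a⋆, and let h : A⁺ → S be the
-- evaluation morphism; the languages are the fibres h⁻¹(s).  Each syntactic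
-- ⋆-congruence ≈_L is a congruence compatible with †, so the image T of the
-- diagonal w ↦ ([w]_L)_L is a sub-⋆-semigroup of the product.  If w ≈_{h⁻¹(s)} w′
-- for s = h(w), then h(w′) = s, so h factors through T as a surjective morphism.

module Submission where

open import Defs
open import Data.Nat using (ℕ; suc)
open import Data.Fin using (Fin; zero; suc)
open import Data.Fin.Properties using (any?; _≟_)
open import Data.Product using (Σ; _×_; _,_; proj₁; proj₂; ∃-syntax)
open import Data.Unit using (⊤)
open import Data.Empty using (⊥-elim)
open import Data.List as List using (List; []; _∷_; _++_)
open import Data.List.Properties
  using (++-assoc; ++-identityʳ; map-++; reverse-++; reverse-map; reverse-involutive; map-∘; map-cong; map-id)
open import Data.List.NonEmpty as List⁺ using (List⁺; _∷_; toList; _⁺++⁺_; _⁺++_; _++⁺_)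
import Data.Vec as Vec
import Data.Vec.Properties as Vec
open import Function.Bundles using (_↔_; _⇔_; mk⇔; Inverse; Equivalence)
import Function.Properties.Equivalence as ⇔
open import Relation.Binary.PropositionalEquality
open import Relation.Nullary using (yes; no)

open ≡-Reasoning

module _ {X : Set} where

  toList-injective : {u v : List⁺ X} → toList u ≡ toList v → u ≡ v
  toList-injective {_ ∷ _} {_ ∷ _} refl = refl

  toList-++⁺ : (xs : List X) (w : List⁺ X) → toList (xs ++⁺ w) ≡ xs ++ toList w
  toList-++⁺ []       w = refl
  toList-++⁺ (x ∷ xs) w = cong (x ∷_) (toList-++⁺ xs w)

  toList-reverse : (w : List⁺ X) → toList (List⁺.reverse w) ≡ List.reverse (toList w)
  toList-reverse (x ∷ xs) = begin
    toList (List⁺.fromVec (Vec.reverse v))  ≡⟨ toList-fromVec (Vec.reverse v) ⟩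
    Vec.toList (Vec.reverse v)              ≡⟨ Vec.toList-reverse v ⟩
    List.reverse (x ∷ Vec.toList (Vec.fromList xs))
      ≡⟨ cong (λ ys → List.reverse (x ∷ ys)) (Vec.toList∘fromList xs) ⟩
    List.reverse (x ∷ xs)                   ∎
    where
    v = x Vec.∷ Vec.fromList xs
    toList-fromVec : ∀ {k} (u : Vec.Vec X (suc k)) → toList (List⁺.fromVec u) ≡ Vec.toList u
    toList-fromVec (y Vec.∷ ys) = refl

  ⁺++-identityʳ : (w : List⁺ X) → w ⁺++ [] ≡ w
  ⁺++-identityʳ (x ∷ xs) = cong (x ∷_) (++-identityʳ xs)

  plug : List X → List⁺ X → List X → List⁺ X
  plug u x v = u ++⁺ (x ⁺++ v)

  plug-≡ : ∀ {u x v u′ x′ v′} → u ++ toList x ++ v ≡ u′ ++ toList x′ ++ v′ →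
           plug u x v ≡ plug u′ x′ v′
  plug-≡ {u} {x} {v} {u′} {x′} {v′} eq = toList-injective (begin
    toList (plug u x v)     ≡⟨ toList-++⁺ u (x ⁺++ v) ⟩
    u ++ toList x ++ v      ≡⟨ eq ⟩
    u′ ++ toList x′ ++ v′   ≡⟨ toList-++⁺ u′ (x′ ⁺++ v′) ⟨
    toList (plug u′ x′ v′)  ∎)

  plug-⁺++⁺ʳ : ∀ u x z v → plug u (x ⁺++⁺ z) v ≡ plug u x (toList z ++ v)
  plug-⁺++⁺ʳ u x z v =
    plug-≡ {x = x ⁺++⁺ z} {x′ = x} (cong (u ++_) (++-assoc (toList x) (toList z) v))

  plug-⁺++⁺ˡ : ∀ u z x v → plug u (z ⁺++⁺ x) v ≡ plug (u ++ toList z) x v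
  plug-⁺++⁺ˡ u z x v = plug-≡ {x = z ⁺++⁺ x} {x′ = x} (begin
    u ++ (toList z ++ toList x) ++ v  ≡⟨ cong (u ++_) (++-assoc (toList z) (toList x) v) ⟩
    u ++ toList z ++ toList x ++ v    ≡⟨ ++-assoc u (toList z) _ ⟨
    (u ++ toList z) ++ toList x ++ v  ∎)

module _ (A : InvAlphabet) where

  dagL : List (Fin (size A)) → List (Fin (size A))
  dagL xs = List.reverse (List.map (inv A) xs)

  dagL-++ : ∀ xs ys → dagL (xs ++ ys) ≡ dagL ys ++ dagL xs
  dagL-++ xs ys =
    trans (cong List.reverse (map-++ (inv A) xs ys)) (reverse-++ (List.map (inv A) xs) _)

  dagL-involutive : ∀ xs → dagL (dagL xs) ≡ xs
  dagL-involutive xs = begin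
    List.reverse (List.map (inv A) (List.reverse (List.map (inv A) xs)))
      ≡⟨ cong List.reverse (reverse-map (inv A) (List.map (inv A) xs)) ⟩
    List.reverse (List.reverse (List.map (inv A) (List.map (inv A) xs)))
      ≡⟨ reverse-involutive _ ⟩
    List.map (inv A) (List.map (inv A) xs)
      ≡⟨ map-∘ xs ⟨
    List.map (λ a → inv A (inv A a)) xs
      ≡⟨ map-cong (inv-invol A) xs ⟩
    List.map (λ a → a) xs
      ≡⟨ map-id xs ⟩
    xs ∎

  toList-dagW : ∀ w → toList (dagW A w) ≡ dagL (toList w)
  toList-dagW w = toList-reverse (List⁺.map (inv A) w)

  dagW-involutive : ∀ w → dagW A (dagW A w) ≡ w
  dagW-involutive w = toList-injective (begin
    toList (dagW A (dagW A w))  ≡⟨ toList-dagW (dagW A w) ⟩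
    dagL (toList (dagW A w))    ≡⟨ cong dagL (toList-dagW w) ⟩
    dagL (dagL (toList w))      ≡⟨ dagL-involutive (toList w) ⟩
    toList w                    ∎)

  dagW-⁺++⁺ : ∀ u v → dagW A (u ⁺++⁺ v) ≡ dagW A v ⁺++⁺ dagW A u
  dagW-⁺++⁺ u v = toList-injective (begin
    toList (dagW A (u ⁺++⁺ v))           ≡⟨ toList-dagW (u ⁺++⁺ v) ⟩
    dagL (toList u ++ toList v)          ≡⟨ dagL-++ (toList u) (toList v) ⟩
    dagL (toList v) ++ dagL (toList u)   ≡⟨ cong₂ _++_ (toList-dagW v) (toList-dagW u) ⟨
    toList (dagW A v ⁺++⁺ dagW A u)      ∎)

  dagW-plug : ∀ u x v → dagW A (plug u x v) ≡ plug (dagL v) (dagW A x) (dagL u)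
  dagW-plug u x v = toList-injective (begin
    toList (dagW A (plug u x v))                    ≡⟨ toList-dagW (plug u x v) ⟩
    dagL (toList (plug u x v))                      ≡⟨ cong dagL (toList-++⁺ u (x ⁺++ v)) ⟩
    dagL (u ++ toList x ++ v)                       ≡⟨ dagL-++ u (toList x ++ v) ⟩
    dagL (toList x ++ v) ++ dagL u                  ≡⟨ cong (_++ dagL u) (dagL-++ (toList x) v) ⟩
    (dagL v ++ dagL (toList x)) ++ dagL u           ≡⟨ ++-assoc (dagL v) _ _ ⟩
    dagL v ++ dagL (toList x) ++ dagL u             ≡⟨ cong (λ ys → dagL v ++ ys ++ dagL u) (toList-dagW x) ⟨
    dagL v ++ toList (dagW A x) ++ dagL u           ≡⟨ toList-++⁺ (dagL v) (dagW A x ⁺++ dagL u) ⟨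
    toList (plug (dagL v) (dagW A x) (dagL u))      ∎)

  module _ (L : Language A) where

    Syn∼-refl : ∀ {x} → Syn∼ A L x x
    Syn∼-refl u v = ⇔.refl

    Syn∼-sym : ∀ {x y} → Syn∼ A L x y → Syn∼ A L y x
    Syn∼-sym x∼y u v = ⇔.sym (x∼y u v)

    Syn∼-trans : ∀ {x y z} → Syn∼ A L x y → Syn∼ A L y z → Syn∼ A L x z
    Syn∼-trans x∼y y∼z u v = ⇔.trans (x∼y u v) (y∼z u v)

    Syn∼⇒⇔ : ∀ {x y} → Syn∼ A L x y → L x ⇔ L y
    Syn∼⇒⇔ {x} {y} x∼y =
      subst₂ (λ x′ y′ → L x′ ⇔ L y′) (⁺++-identityʳ x) (⁺++-identityʳ y) (x∼y [] [])

    Syn∼-⁺++⁺ʳ : ∀ {x y} z → Syn∼ A L x y → Syn∼ A L (x ⁺++⁺ z) (y ⁺++⁺ z)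
    Syn∼-⁺++⁺ʳ {x} {y} z x∼y u v
      rewrite plug-⁺++⁺ʳ u x z v | plug-⁺++⁺ʳ u y z v = x∼y u (toList z ++ v)

    Syn∼-⁺++⁺ˡ : ∀ {x y} z → Syn∼ A L x y → Syn∼ A L (z ⁺++⁺ x) (z ⁺++⁺ y)
    Syn∼-⁺++⁺ˡ {x} {y} z x∼y u v
      rewrite plug-⁺++⁺ˡ u z x v | plug-⁺++⁺ˡ u z y v = x∼y (u ++ toList z) v

    Syn∼-⁺++⁺ : ∀ {x y x′ y′} → Syn∼ A L x y → Syn∼ A L x′ y′ →
                Syn∼ A L (x ⁺++⁺ x′) (y ⁺++⁺ y′)
    Syn∼-⁺++⁺ {x} {y} {x′} {y′} x∼y x′∼y′ =
      Syn∼-trans {x ⁺++⁺ x′} {y ⁺++⁺ x′} (Syn∼-⁺++⁺ʳ x′ x∼y) (Syn∼-⁺++⁺ˡ y x′∼y′)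

  Syn∼-dagW : ∀ L L′ {x y} → (∀ w → L w ⇔ L′ (dagW A w)) →
              Syn∼ A L′ x y → Syn∼ A L (dagW A x) (dagW A y)
  Syn∼-dagW L L′ {x} {y} L⇔L′† x∼y u v =
    ⇔.trans (reflect x) (⇔.trans (x∼y (dagL v) (dagL u)) (⇔.sym (reflect y)))
    where
    reflect : ∀ z → L (plug u (dagW A z) v) ⇔ L′ (plug (dagL v) z (dagL u))
    reflect z = subst (λ w → L (plug u (dagW A z) v) ⇔ L′ w)
      (trans (dagW-plug u (dagW A z) v) (cong (λ z′ → plug (dagL v) z′ (dagL u)) (dagW-involutive z)))
      (L⇔L′† (plug u (dagW A z) v))

  module _ (L : Language A) where

    Dag⇔dagW : ∀ w → Dag A L w ⇔ L (dagW A w)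
    Dag⇔dagW w = mk⇔
      (λ { (v , Lv , refl) → subst L (sym (dagW-involutive v)) Lv })
      (λ Lw† → dagW A w , Lw† , sym (dagW-involutive w))

    ⇔Dag-dagW : ∀ w → L w ⇔ Dag A L (dagW A w)
    ⇔Dag-dagW w = ⇔.sym (subst (λ w′ → Dag A L (dagW A w) ⇔ L w′)
                                (dagW-involutive w) (Dag⇔dagW (dagW A w)))

    Syn≈-refl : ∀ {x} → Syn≈ A L x x
    Syn≈-refl {x} = Syn∼-refl L {x} , Syn∼-refl (Dag A L) {x}

    Syn≈-sym : ∀ {x y} → Syn≈ A L x y → Syn≈ A L y x
    Syn≈-sym {x} {y} (x∼y , x∼†y) = Syn∼-sym L {x} {y} x∼y , Syn∼-sym (Dag A L) {x} {y} x∼†y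

    Syn≈-trans : ∀ {x y z} → Syn≈ A L x y → Syn≈ A L y z → Syn≈ A L x z
    Syn≈-trans {x} {y} {z} (x∼y , x∼†y) (y∼z , y∼†z) =
      Syn∼-trans L {x} {y} {z} x∼y y∼z , Syn∼-trans (Dag A L) {x} {y} {z} x∼†y y∼†z

    Syn≈-⁺++⁺ : ∀ {x y x′ y′} → Syn≈ A L x y → Syn≈ A L x′ y′ →
                Syn≈ A L (x ⁺++⁺ x′) (y ⁺++⁺ y′)
    Syn≈-⁺++⁺ {x} {y} {x′} {y′} (x∼y , x∼†y) (x′∼y′ , x′∼†y′) =
      Syn∼-⁺++⁺ L {x} {y} {x′} {y′} x∼y x′∼y′ ,
      Syn∼-⁺++⁺ (Dag A L) {x} {y} {x′} {y′} x∼†y x′∼†y′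

    Syn≈-dagW : ∀ {x y} → Syn≈ A L x y → Syn≈ A L (dagW A x) (dagW A y)
    Syn≈-dagW {x} {y} (x∼y , x∼†y) =
      Syn∼-dagW L (Dag A L) {x} {y} ⇔Dag-dagW x∼†y ,
      Syn∼-dagW (Dag A L) L {x} {y} Dag⇔dagW x∼y

module Evaluation (S : InvSemigroup) (A : InvAlphabet) (f : Fin (size A) → Carrier S)
                  (f-inv : ∀ a → f (inv A a) ≡ _⋆ S (f a)) where

  private
    _·_ = _∙_ S

  evalFrom : Fin (size A) → List (Fin (size A)) → Carrier S
  evalFrom a []       = f a
  evalFrom a (b ∷ bs) = f a · evalFrom b bs

  eval : Word A → Carrier S
  eval (a ∷ as) = evalFrom a as

  eval-⁺++⁺ : ∀ u v → eval (u ⁺++⁺ v) ≡ eval u · eval v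
  eval-⁺++⁺ (a ∷ as) v = evalFrom-++ a as
    where
    evalFrom-++ : ∀ a as → evalFrom a (as ++ toList v) ≡ evalFrom a as · eval v
    evalFrom-++ a []       = refl
    evalFrom-++ a (b ∷ bs) = begin
      f a · evalFrom b (bs ++ toList v)    ≡⟨ cong (f a ·_) (evalFrom-++ b bs) ⟩
      f a · (evalFrom b bs · eval v)       ≡⟨ assoc S (f a) _ _ ⟨
      (f a · evalFrom b bs) · eval v       ∎

  eval-dagW : ∀ w → eval (dagW A w) ≡ _⋆ S (eval w)
  eval-dagW (a ∷ as) = eval-dagW-∷ a as
    where
    eval-dagW-∷ : ∀ a as → eval (dagW A (a ∷ as)) ≡ _⋆ S (evalFrom a as)
    eval-dagW-∷ a []       = f-inv a
    eval-dagW-∷ a (b ∷ bs) = begin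
      eval (dagW A ((a ∷ []) ⁺++⁺ (b ∷ bs)))           ≡⟨ cong eval (dagW-⁺++⁺ A (a ∷ []) (b ∷ bs)) ⟩
      eval (dagW A (b ∷ bs) ⁺++⁺ dagW A (a ∷ []))      ≡⟨ eval-⁺++⁺ (dagW A (b ∷ bs)) _ ⟩
      eval (dagW A (b ∷ bs)) · eval (dagW A (a ∷ []))  ≡⟨ cong₂ _·_ (eval-dagW-∷ b bs) (f-inv a) ⟩
      _⋆ S (evalFrom b bs) · _⋆ S (f a)                ≡⟨ ⋆-anti S (f a) _ ⟨
      _⋆ S (f a · evalFrom b bs)                       ∎

  eval-isInvMorphism : IsInvMorphism A S eval
  eval-isInvMorphism = eval-⁺++⁺ , eval-dagW

module Diagonal {A : InvAlphabet} {n : ℕ} (Ls : Fin n → Language A) where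

  _≈_ : Tuple A n → Tuple A n → Set
  _≈_ = _≈ₚ_ {A} {n} {Ls}

  DiagonalImage : Tuple A n → Set
  DiagonalImage t = ∃[ w ] (t ≈ λ _ → w)

  DiagonalImage-resp-≈ : ∀ s t → s ≈ t → DiagonalImage s → DiagonalImage t
  DiagonalImage-resp-≈ s t s≈t (w , s≈w) =
    w , λ i → Syn≈-trans A (Ls i) (Syn≈-sym A (Ls i) (s≈t i)) (s≈w i)

  DiagonalImage-mul : ∀ s t → DiagonalImage s → DiagonalImage t → DiagonalImage (mulₚ {A} s t)
  DiagonalImage-mul s t (w , s≈w) (w′ , t≈w′) =
    w ⁺++⁺ w′ , λ i → Syn≈-⁺++⁺ A (Ls i) (s≈w i) (t≈w′ i)

  DiagonalImage-star : ∀ s → DiagonalImage s → DiagonalImage (starₚ {A} s)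
  DiagonalImage-star s (w , s≈w) = dagW A w , λ i → Syn≈-dagW A (Ls i) (s≈w i)

  DiagonalImage-constant : ∀ w → DiagonalImage (λ _ → w)
  DiagonalImage-constant w = w , λ i → Syn≈-refl A (Ls i) {w}

  ≈-constant⇒⇔ : ∀ {t w} → t ≈ (λ _ → w) → ∀ i → Ls i (t i) ⇔ Ls i w
  ≈-constant⇒⇔ {t} {w} t≈w i = Syn∼⇒⇔ A (Ls i) {t i} {w} (proj₁ (t≈w i))

module FibreDivision (S : InvSemigroup) {m : ℕ} (enum : Carrier S ↔ Fin m)
         {A : InvAlphabet} (h : Word A → Carrier S) (h-isInvMorphism : IsInvMorphism A S h)
         (section : Carrier S → Word A) (h∘section : ∀ x → h (section x) ≡ x) where

  open Inverse enum using (to; from; strictlyInverseʳ)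

  -- Index 0 carries the full language A⁺, a trivial factor that only gives φ a
  -- fallback value (needed when S is empty); index suc j carries h⁻¹(from j).
  target : Fin (suc m) → Carrier S → Set
  target zero    _ = ⊤
  target (suc j) x = to x ≡ j

  fibres : Fin (suc m) → Language A
  fibres i w = target i (h w)

  recognised : ∀ i → Recognises S A (fibres i)
  recognised i = h , h-isInvMorphism , target i , λ _ → ⇔.refl

  open Diagonal {A} fibres

  -- On the diagonal image of w, the only index suc j whose component lies in its
  -- fibre is j = to (h w), so searching for it recovers h w.
  φ : Tuple A (suc m) → Carrier S
  φ t with any? (λ j → to (h (t (suc j))) ≟ j)
  ... | yes (j , _) = from j
  ... | no _        = h (t zero)

  φ-diagonal : ∀ t → (d : DiagonalImage t) → φ t ≡ h (proj₁ d)
  φ-diagonal t (w , t≈w) with any? (λ j → to (h (t (suc j))) ≟ j)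
  ... | yes (j , tⱼ∈Lⱼ) = begin
    from j          ≡⟨ cong from (Equivalence.to (≈-constant⇒⇔ t≈w (suc j)) tⱼ∈Lⱼ) ⟨
    from (to (h w)) ≡⟨ strictlyInverseʳ (h w) ⟩
    h w             ∎
  ... | no ∄j =
    ⊥-elim (∄j (to (h w) , Equivalence.from (≈-constant⇒⇔ t≈w (suc (to (h w)))) refl))

  φ-resp-≈ : ∀ s t → DiagonalImage s → s ≈ t → φ s ≡ φ t
  φ-resp-≈ s t ds s≈t =
    trans (φ-diagonal s ds) (sym (φ-diagonal t (DiagonalImage-resp-≈ s t s≈t ds)))

  φ-mul : ∀ s t → DiagonalImage s → DiagonalImage t →
          φ (mulₚ {A} s t) ≡ _∙_ S (φ s) (φ t)
  φ-mul s t ds@(w , _) dt@(w′ , _) = begin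
    φ (mulₚ {A} s t)   ≡⟨ φ-diagonal (mulₚ {A} s t) (DiagonalImage-mul s t ds dt) ⟩
    h (w ⁺++⁺ w′)      ≡⟨ proj₁ h-isInvMorphism w w′ ⟩
    _∙_ S (h w) (h w′) ≡⟨ cong₂ (_∙_ S) (φ-diagonal s ds) (φ-diagonal t dt) ⟨
    _∙_ S (φ s) (φ t)  ∎

  φ-star : ∀ s → DiagonalImage s → φ (starₚ {A} s) ≡ _⋆ S (φ s)
  φ-star s ds@(w , _) = begin
    φ (starₚ {A} s) ≡⟨ φ-diagonal (starₚ {A} s) (DiagonalImage-star s ds) ⟩
    h (dagW A w)    ≡⟨ proj₂ h-isInvMorphism w ⟩
    _⋆ S (h w)      ≡⟨ cong (_⋆ S) (φ-diagonal s ds) ⟨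
    _⋆ S (φ s)      ∎

  φ-surjective : ∀ x → ∃[ t ] (DiagonalImage t × φ t ≡ x)
  φ-surjective x = (λ _ → section x) , diagonal ,
                   trans (φ-diagonal (λ _ → section x) diagonal) (h∘section x)
    where
    diagonal = DiagonalImage-constant (section x)

  divides : Divides S A (suc m) fibres
  divides =
    DiagonalImage , φ ,
    DiagonalImage-resp-≈ , DiagonalImage-mul , DiagonalImage-star ,
    (λ s t ds _ → φ-resp-≈ s t ds) , φ-mul , φ-star , φ-surjective

module ElementAlphabet (S : InvSemigroup) {m : ℕ} (enum : Carrier S ↔ Fin m) where

  open Inverse enum using (to; from; strictlyInverseˡ; strictlyInverseʳ)

  alphabet : InvAlphabet
  alphabet = record { size = m ; inv = λ a → to (_⋆ S (from a)) ; inv-invol = inv-invol′ }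
    where
    inv-invol′ : ∀ a → to (_⋆ S (from (to (_⋆ S (from a))))) ≡ a
    inv-invol′ a = begin
      to (_⋆ S (from (to (_⋆ S (from a)))))  ≡⟨ cong (λ x → to (_⋆ S x)) (strictlyInverseʳ _) ⟩
      to (_⋆ S (_⋆ S (from a)))              ≡⟨ cong to (⋆-invol S (from a)) ⟩
      to (from a)                            ≡⟨ strictlyInverseˡ a ⟩
      a                                      ∎

  open Evaluation S alphabet from (λ a → strictlyInverseʳ _) public
    using (eval; eval-isInvMorphism)

  letter : Carrier S → Word alphabet
  letter x = to x ∷ []

  eval-letter : ∀ x → eval (letter x) ≡ x
  eval-letter = strictlyInverseʳ

proposition5 : (S : InvSemigroup) → IsFinite S →
    Σ InvAlphabet λ A → Σ ℕ λ n → Σ (Fin n → Language A) λ Ls →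
      ((i : Fin n) → Recognises S A (Ls i)) × Divides S A n Ls
proposition5 S (m , enum) = alphabet , suc m , fibres , recognised , divides
  where
  open ElementAlphabet S enum
  open FibreDivision S enum {alphabet} eval eval-isInvMorphism letter eval-letter
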